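{- For every odd integer $t\geq 1$ there exist integers $a_{t,0},\dots,a_{t,7}$ and formal power series $F_{t,0},\dots,F_{t,7}\in\mathbb{Z}[[x]]$ such that $$\left(\phi(q)\,\phi(q^2)^2\,\phi(q^4)^4\right)^t=\sum_{j=0}^{7}a_{t,j}\,q^j\,F_{t,j}(q^8),$$ and $a_{t,1}\equiv 0 \pmod 2$, $a_{t,2}\equiv 0 \pmod 4$, $a_{t,3}\equiv 0\pmod 8$, $a_{t,4}\equiv 0\pmod 2$, $a_{t,5}\equiv 0\pmod 8$, $a_{t,6}\equiv 0\pmod 8$, $a_{t,7}\equiv 0\pmod{32}$.
   Context: Ramanujan's theta function is $\phi(q)=\sum_{k=-\infty}^{\infty}q^{k^2}$, viewed as a formal power series in $q$ with integer coefficients. -}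

module Defs where

open import Data.Nat as ℕ using (ℕ; zero; suc; NonZero; _∸_)
open import Data.Nat.Divisibility using (_∣?_)
open import Data.Nat.DivMod using (_/_)
open import Data.Integer as ℤ using (ℤ; +_; -[1+_])
open import Data.Fin using (Fin)
import Data.Fin as Fin
open import Data.List using (List; _++_; map; upTo; filter; length)
open import Relation.Nullary.Decidable using (does)
open import Data.Bool using (if_then_else_)

-- Formal power series in ℤ[[x]], represented by their coefficient sequences:
-- (F n) is the coefficient of x^n.
Series : Set
Series = ℕ → ℤ

sumFin : (n : ℕ) → (Fin n → ℤ) → ℤ
sumFin zero    f = + 0
sumFin (suc n) f = f Fin.zero ℤ.+ sumFin n (λ i → f (Fin.suc i))

sumUpTo : ℕ → (ℕ → ℤ) → ℤ
sumUpTo zero    f = f 0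
sumUpTo (suc m) f = sumUpTo m f ℤ.+ f (suc m)

_⊛_ : Series → Series → Series
(f ⊛ g) n = sumUpTo n (λ k → f k ℤ.* g (n ∸ k))

infixl 7 _⊛_

one : Series
one zero    = + 1
one (suc _) = + 0

_^ˢ_ : Series → ℕ → Series
F ^ˢ zero  = one
F ^ˢ suc t = F ⊛ (F ^ˢ t)

-- F(q^m) : coefficient of q^n is F (n/m) if m ∣ n, else 0.
dilate : (m : ℕ) .{{_ : NonZero m}} → Series → Series
dilate m F n = if does (m ∣? n) then F (n / m) else + 0

-- q^j · F(q) : coefficient of q^n is F (n - j) if j ≤ n, else 0.
shift : ℕ → Series → Series
shift j F n = if does (j ℕ.≤? n) then F (n ∸ j) else + 0

intsUpTo : ℕ → List ℤ
intsUpTo n = map +_ (upTo (suc n)) ++ map -[1+_] (upTo n)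

-- Ramanujan's theta function φ(q) = Σ_{k ∈ ℤ} q^{k²}:
-- the coefficient of q^n is #{k ∈ ℤ : k² = n}.  Every such k satisfies
-- |k| ≤ k² = n, so it suffices to count over -n ≤ k ≤ n.
phi : Series
phi n = + length (filter (λ k → k ℤ.* k ℤ.≟ + n) (intsUpTo n))

-- A bound for a series G is a function b on residues mod 8 such that b (n mod 8)
-- divides the coefficient of q^n in G for every n (b r = 0 meaning that these
-- coefficients vanish).  Bounds propagate through Cauchy products, and more sharply
-- through squares: there the terms k and n − k of the coefficient sum pair up and
-- contribute an extra factor 2.  The coefficients of φ vanish unless n ≡ 0, 1, 4
-- (mod 8) and are even for n > 0, so finitely many checks over residues give the
-- bound (1,2,4,8,2,8,8,32) for Φ = φ(q) φ(q²)² φ(q⁴)⁴ and the bound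
-- (1,4,4,16,4,8,16,32) for Φ², which is closed under multiplication.  Every odd
-- power Φ · (Φ²)^k therefore has the bound of Φ, and grouping its coefficients by
-- residue class gives a_{t,j} = b(j) and the series F_{t,j}.
module Submission where

open import Defs
open import Data.Nat as ℕ using (ℕ; zero; suc; _∸_; _≤_; _%_; _/_; NonZero)
import Data.Nat.Properties as ℕP
import Data.Nat.Divisibility as ℕ
open import Data.Nat.DivMod using (_mod_; %-distribˡ-+; %-distribˡ-*; m%n<n; m%n≤m; m≡m%n+[m/n]*n; [m+kn]%n≡m%n; m<n⇒m%n≡m; m*n/n≡m)
open import Data.Fin as Fin using (Fin; toℕ; #_)
open import Data.Fin.Properties using (toℕ-fromℕ<; fromℕ<-cong; toℕ-injective; suc-injective; toℕ<n; all?)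
open import Data.Product using (_×_; _,_; Σ)
open import Data.Sum using (_⊎_; inj₁; inj₂)
open import Data.List using (List; []; _∷_; _++_; map; filter; length; upTo; applyUpTo)
open import Data.List.Properties using (filter-++; length-++; filter-none; map-applyUpTo)
open import Data.List.Relation.Unary.All using (universal)
open import Data.Vec using (_∷_; []; lookup)
open import Relation.Unary using (Pred; Decidable)
open import Relation.Nullary using (Dec; does; yes; no; ¬_)
open import Relation.Nullary.Decidable using (_×-dec_; _⊎-dec_; ¬?; dec-true; dec-false; from-yes)
open import Data.Bool using (true; false; if_then_else_)
open import Data.Integer as ℤ using (ℤ; +_; -[1+_]; _+_; _*_; ∣_∣)
import Data.Integer.Properties as ℤP
open import Data.Integer.Divisibility using (_∣_)
open import Data.Integer.Tactic.RingSolver using (solve-∀)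
open import Data.Nat.Tactic.RingSolver renaming (solve-∀ to ℕ-solve-∀)
-- Signed divisibility is closed under sums; the theorem is stated with the unsigned _∣_.
open import Data.Integer.Divisibility.Signed using (divides; ∣m∣n⇒∣m+n; ∣-trans; ∣-refl; ∣ᵤ⇒∣; *-monoʳ-∣; *-monoˡ-∣) renaming (_∣_ to _∣ᶻ_)
open import Function using (_∘_; id)
open import Relation.Binary.PropositionalEquality

sumUpTo-cong : ∀ n {f g : ℕ → ℤ} → f ≗ g → sumUpTo n f ≡ sumUpTo n g
sumUpTo-cong zero    f≗g = f≗g 0
sumUpTo-cong (suc n) f≗g = cong₂ _+_ (sumUpTo-cong n f≗g) (f≗g (suc n))

sumUpTo-suc : ∀ n (f : ℕ → ℤ) → sumUpTo (suc n) f ≡ f 0 + sumUpTo n (f ∘ suc)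
sumUpTo-suc zero    f = refl
sumUpTo-suc (suc n) f = begin
  sumUpTo (suc n) f + f (2 ℕ.+ n)                 ≡⟨ cong (_+ f (2 ℕ.+ n)) (sumUpTo-suc n f) ⟩
  f 0 + sumUpTo n (f ∘ suc) + f (2 ℕ.+ n)         ≡⟨ ℤP.+-assoc (f 0) _ _ ⟩
  f 0 + sumUpTo (suc n) (f ∘ suc)                 ∎
  where open ≡-Reasoning

sumUpTo-+ : ∀ n (f g : ℕ → ℤ) → sumUpTo n (λ k → f k + g k) ≡ sumUpTo n f + sumUpTo n g
sumUpTo-+ zero    f g = refl
sumUpTo-+ (suc n) f g = trans (cong (_+ (f (suc n) + g (suc n))) (sumUpTo-+ n f g))
  (interchange (sumUpTo n f) (sumUpTo n g) (f (suc n)) (g (suc n)))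
  where
  interchange : ∀ a b c d → (a + b) + (c + d) ≡ (a + c) + (b + d)
  interchange = solve-∀

sumUpTo-*ˡ : ∀ n c (f : ℕ → ℤ) → sumUpTo n (λ k → c * f k) ≡ c * sumUpTo n f
sumUpTo-*ˡ zero    c f = refl
sumUpTo-*ˡ (suc n) c f = trans (cong (_+ c * f (suc n)) (sumUpTo-*ˡ n c f)) (sym (ℤP.*-distribˡ-+ c _ _))

tail : Series → Series
tail f = f ∘ suc

⊛-suc : ∀ f g n → (f ⊛ g) (suc n) ≡ f 0 * g (suc n) + (tail f ⊛ g) n
⊛-suc f g n = sumUpTo-suc n (λ k → f k * g (suc n ∸ k))

⊛-congˡ : ∀ {f f′} g → f ≗ f′ → f ⊛ g ≗ f′ ⊛ g
⊛-congˡ g f≗f′ n = sumUpTo-cong n (λ k → cong (_* g (n ∸ k)) (f≗f′ k))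

⊛-congʳ : ∀ f {g g′} → g ≗ g′ → f ⊛ g ≗ f ⊛ g′
⊛-congʳ f g≗g′ n = sumUpTo-cong n (λ k → cong (f k *_) (g≗g′ (n ∸ k)))

⊛-distribʳ-linear : ∀ c f g h → (λ k → c * f k + g k) ⊛ h ≗ λ n → c * (f ⊛ h) n + (g ⊛ h) n
⊛-distribʳ-linear c f g h n = begin
  sumUpTo n (λ k → (c * f k + g k) * h (n ∸ k))
    ≡⟨ sumUpTo-cong n (λ k → ℤP.*-distribʳ-+ (h (n ∸ k)) (c * f k) (g k)) ⟩
  sumUpTo n (λ k → c * f k * h (n ∸ k) + g k * h (n ∸ k))
    ≡⟨ sumUpTo-+ n _ _ ⟩
  sumUpTo n (λ k → c * f k * h (n ∸ k)) + (g ⊛ h) n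
    ≡⟨ cong (_+ (g ⊛ h) n) (sumUpTo-cong n (λ k → ℤP.*-assoc c (f k) (h (n ∸ k)))) ⟩
  sumUpTo n (λ k → c * (f k * h (n ∸ k))) + (g ⊛ h) n
    ≡⟨ cong (_+ (g ⊛ h) n) (sumUpTo-*ˡ n c _) ⟩
  c * (f ⊛ h) n + (g ⊛ h) n ∎
  where open ≡-Reasoning

⊛-assoc : ∀ f g h → (f ⊛ g) ⊛ h ≗ f ⊛ (g ⊛ h)
⊛-assoc f g h zero    = ℤP.*-assoc (f 0) (g 0) (h 0)
⊛-assoc f g h (suc n) = begin
  ((f ⊛ g) ⊛ h) (suc n)
    ≡⟨ ⊛-suc (f ⊛ g) h n ⟩
  f 0 * g 0 * h (suc n) + (tail (f ⊛ g) ⊛ h) n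
    ≡⟨ cong (λ z → lead + z) (⊛-congˡ h (⊛-suc f g) n) ⟩
  f 0 * g 0 * h (suc n) + ((λ k → f 0 * tail g k + (tail f ⊛ g) k) ⊛ h) n
    ≡⟨ cong (λ z → lead + z) (⊛-distribʳ-linear (f 0) (tail g) (tail f ⊛ g) h n) ⟩
  f 0 * g 0 * h (suc n) + (f 0 * (tail g ⊛ h) n + ((tail f ⊛ g) ⊛ h) n)
    ≡⟨ cong (λ z → lead + (f 0 * (tail g ⊛ h) n + z)) (⊛-assoc (tail f) g h n) ⟩
  f 0 * g 0 * h (suc n) + (f 0 * (tail g ⊛ h) n + (tail f ⊛ (g ⊛ h)) n)
    ≡⟨ regroup (f 0) (g 0) (h (suc n)) _ _ ⟩
  f 0 * (g 0 * h (suc n) + (tail g ⊛ h) n) + (tail f ⊛ (g ⊛ h)) n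
    ≡⟨ cong (λ z → f 0 * z + (tail f ⊛ (g ⊛ h)) n) (⊛-suc g h n) ⟨
  f 0 * (g ⊛ h) (suc n) + (tail f ⊛ (g ⊛ h)) n
    ≡⟨ ⊛-suc f (g ⊛ h) n ⟨
  (f ⊛ (g ⊛ h)) (suc n) ∎
  where
  open ≡-Reasoning
  lead : ℤ
  lead = f 0 * g 0 * h (suc n)
  regroup : ∀ a b c x y → a * b * c + (a * x + y) ≡ a * (b * c + x) + y
  regroup = solve-∀

⊛-identityʳ : ∀ f → f ⊛ one ≗ f
⊛-identityʳ f zero    = ℤP.*-identityʳ (f 0)
⊛-identityʳ f (suc n) = begin
  (f ⊛ one) (suc n)              ≡⟨ ⊛-suc f one n ⟩
  f 0 * + 0 + (tail f ⊛ one) n   ≡⟨ cong (_+ (tail f ⊛ one) n) (ℤP.*-zeroʳ (f 0)) ⟩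
  + 0 + (tail f ⊛ one) n         ≡⟨ ℤP.+-identityˡ _ ⟩
  (tail f ⊛ one) n               ≡⟨ ⊛-identityʳ (tail f) n ⟩
  f (suc n)                      ∎
  where open ≡-Reasoning

^ˢ-2 : ∀ F → F ^ˢ 2 ≗ F ⊛ F
^ˢ-2 F = ⊛-congʳ F (⊛-identityʳ F)

^ˢ-*2 : ∀ F k → F ^ˢ (k ℕ.* 2) ≗ (F ⊛ F) ^ˢ k
^ˢ-*2 F zero    n = refl
^ˢ-*2 F (suc k) n = trans (sym (⊛-assoc F F (F ^ˢ (k ℕ.* 2)) n)) (⊛-congʳ (F ⊛ F) (^ˢ-*2 F k) n)

∣-sumUpTo : ∀ {d} n (f : ℕ → ℤ) → (∀ k → k ≤ n → d ∣ᶻ f k) → d ∣ᶻ sumUpTo n f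
∣-sumUpTo zero    f d∣f = d∣f 0 ℕ.z≤n
∣-sumUpTo (suc n) f d∣f =
  ∣m∣n⇒∣m+n (∣-sumUpTo n f (λ k k≤n → d∣f k (ℕP.m≤n⇒m≤1+n k≤n))) (d∣f (suc n) ℕP.≤-refl)

∣0 : ∀ {d} → d ∣ᶻ + 0
∣0 = divides (+ 0) refl

*-pres-∣ : ∀ {a b x y} → a ∣ᶻ x → b ∣ᶻ y → a * b ∣ᶻ x * y
*-pres-∣ {a} {y = y} a∣x b∣y = ∣-trans (*-monoʳ-∣ a b∣y) (*-monoˡ-∣ y a∣x)

pos-*-pres-∣ : ∀ {a b x y} → + a ∣ᶻ x → + b ∣ᶻ y → + (a ℕ.* b) ∣ᶻ x * y
pos-*-pres-∣ {a} {b} a∣x b∣y = subst (_∣ᶻ _) (sym (ℤP.pos-* a b)) (*-pres-∣ a∣x b∣y)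

∣-sumUpTo-palindrome : ∀ {d} n (f : ℕ → ℤ) →
  (∀ k → k ≤ n → f k ≡ f (n ∸ k)) →
  (∀ k → k ≤ n → d ∣ᶻ f k + f k) →
  (∀ k → k ℕ.+ k ≡ n → d ∣ᶻ f k) →
  d ∣ᶻ sumUpTo n f
∣-sumUpTo-palindrome zero          f sym-f ∣2f ∣f-mid = ∣f-mid 0 refl
∣-sumUpTo-palindrome (suc zero)    f sym-f ∣2f ∣f-mid =
  subst (λ x → _ ∣ᶻ f 0 + x) (sym (sym-f 1 ℕP.≤-refl)) (∣2f 0 ℕ.z≤n)
∣-sumUpTo-palindrome (suc (suc m)) f sym-f ∣2f ∣f-mid =
  subst (_ ∣ᶻ_) (sym sum-split) (∣m∣n⇒∣m+n (∣2f 0 ℕ.z≤n) inner)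
  where
  open ≡-Reasoning
  outer-swap : ∀ a s b → (a + s) + b ≡ (a + b) + s
  outer-swap = solve-∀
  sum-split : sumUpTo (suc (suc m)) f ≡ (f 0 + f 0) + sumUpTo m (f ∘ suc)
  sum-split = begin
    sumUpTo (suc m) f + f (2 ℕ.+ m)             ≡⟨ cong (_+ f (2 ℕ.+ m)) (sumUpTo-suc m f) ⟩
    f 0 + sumUpTo m (f ∘ suc) + f (2 ℕ.+ m)     ≡⟨ outer-swap (f 0) _ _ ⟩
    f 0 + f (2 ℕ.+ m) + sumUpTo m (f ∘ suc)     ≡⟨ cong (λ x → f 0 + x + sumUpTo m (f ∘ suc)) (sym-f 0 ℕ.z≤n) ⟨
    f 0 + f 0 + sumUpTo m (f ∘ suc)             ∎
  inner : _ ∣ᶻ sumUpTo m (f ∘ suc)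
  inner = ∣-sumUpTo-palindrome m (f ∘ suc)
    (λ k k≤m → trans (sym-f (suc k) (ℕ.s≤s (ℕP.m≤n⇒m≤1+n k≤m))) (cong f (ℕP.+-∸-assoc 1 k≤m)))
    (λ k k≤m → ∣2f (suc k) (ℕ.s≤s (ℕP.m≤n⇒m≤1+n k≤m)))
    (λ k k+k≡m → ∣f-mid (suc k) (cong suc (trans (ℕP.+-suc k k) (cong suc k+k≡m))))

sumFin-zero : ∀ n (f : Fin n → ℤ) → (∀ j → f j ≡ + 0) → sumFin n f ≡ + 0
sumFin-zero zero    f f≡0 = refl
sumFin-zero (suc n) f f≡0 = cong₂ _+_ (f≡0 Fin.zero) (sumFin-zero n (f ∘ Fin.suc) (f≡0 ∘ Fin.suc))

sumFin-single : ∀ n (f : Fin n → ℤ) r → (∀ j → j ≢ r → f j ≡ + 0) → sumFin n f ≡ f r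
sumFin-single (suc n) f Fin.zero    f≡0 = begin
  f Fin.zero + sumFin n (f ∘ Fin.suc) ≡⟨ cong (λ s → f Fin.zero + s) (sumFin-zero n _ (λ j → f≡0 (Fin.suc j) (λ ()))) ⟩
  f Fin.zero + + 0                    ≡⟨ ℤP.+-identityʳ _ ⟩
  f Fin.zero                          ∎
  where open ≡-Reasoning
sumFin-single (suc n) f (Fin.suc r) f≡0 = begin
  f Fin.zero + sumFin n (f ∘ Fin.suc) ≡⟨ cong (_+ sumFin n (f ∘ Fin.suc)) (f≡0 Fin.zero (λ ())) ⟩
  + 0 + sumFin n (f ∘ Fin.suc)        ≡⟨ ℤP.+-identityˡ _ ⟩
  sumFin n (f ∘ Fin.suc)              ≡⟨ sumFin-single n (f ∘ Fin.suc) r (λ j j≢r → f≡0 (Fin.suc j) (j≢r ∘ suc-injective)) ⟩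
  f (Fin.suc r)                       ∎
  where open ≡-Reasoning

shift-≤ : ∀ F {j n} → j ≤ n → shift j F n ≡ F (n ∸ j)
shift-≤ F {j} {n} j≤n = cong (if_then F (n ∸ j) else + 0) (dec-true (j ℕ.≤? n) j≤n)

shift-≰ : ∀ F {j n} → ¬ j ≤ n → shift j F n ≡ + 0
shift-≰ F {j} {n} j≰n = cong (if_then F (n ∸ j) else + 0) (dec-false (j ℕ.≤? n) j≰n)

dilate-∣ : ∀ m .{{_ : NonZero m}} F {n} → m ℕ.∣ n → dilate m F n ≡ F (n / m)
dilate-∣ m F {n} m∣n = cong (if_then F (n / m) else + 0) (dec-true (m ℕ.∣? n) m∣n)

dilate-∤ : ∀ m .{{_ : NonZero m}} F {n} → ¬ m ℕ.∣ n → dilate m F n ≡ + 0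
dilate-∤ m F {n} m∤n = cong (if_then F (n / m) else + 0) (dec-false (m ℕ.∣? n) m∤n)

module ResidueBounds (M : ℕ) .{{_ : NonZero M}} where

  toℕ-mod : ∀ x → toℕ (x mod M) ≡ x % M
  toℕ-mod x = toℕ-fromℕ< (m%n<n x M)

  mod-cong : ∀ {x y} → x % M ≡ y % M → x mod M ≡ y mod M
  mod-cong e = fromℕ<-cong _ _ e (m%n<n _ M) (m%n<n _ M)

  mod-+ : ∀ x y → (toℕ (x mod M) ℕ.+ toℕ (y mod M)) mod M ≡ (x ℕ.+ y) mod M
  mod-+ x y = mod-cong (begin
    (toℕ (x mod M) ℕ.+ toℕ (y mod M)) % M ≡⟨ cong₂ (λ a b → (a ℕ.+ b) % M) (toℕ-mod x) (toℕ-mod y) ⟩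
    (x % M ℕ.+ y % M) % M                 ≡⟨ %-distribˡ-+ x y M ⟨
    (x ℕ.+ y) % M                         ∎)
    where open ≡-Reasoning

  mod-* : ∀ x y → (toℕ (x mod M) ℕ.* toℕ (y mod M)) mod M ≡ (x ℕ.* y) mod M
  mod-* x y = mod-cong (begin
    (toℕ (x mod M) ℕ.* toℕ (y mod M)) % M ≡⟨ cong₂ (λ a b → (a ℕ.* b) % M) (toℕ-mod x) (toℕ-mod y) ⟩
    (x % M ℕ.* (y % M)) % M               ≡⟨ %-distribˡ-* x y M ⟨
    (x ℕ.* y) % M                         ∎)
    where open ≡-Reasoning

  mod-+-∸ : ∀ {k n} → k ≤ n → (toℕ (k mod M) ℕ.+ toℕ ((n ∸ k) mod M)) mod M ≡ n mod M
  mod-+-∸ {k} {n} k≤n = trans (mod-+ k (n ∸ k)) (cong (_mod M) (ℕP.m+[n∸m]≡n k≤n))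

  mod-residue : ∀ (j : Fin M) q → (toℕ j ℕ.+ q ℕ.* M) mod M ≡ j
  mod-residue j q = toℕ-injective (begin
    toℕ ((toℕ j ℕ.+ q ℕ.* M) mod M) ≡⟨ toℕ-mod _ ⟩
    (toℕ j ℕ.+ q ℕ.* M) % M         ≡⟨ [m+kn]%n≡m%n (toℕ j) q M ⟩
    toℕ j % M                       ≡⟨ m<n⇒m%n≡m (toℕ<n j) ⟩
    toℕ j                           ∎)
    where open ≡-Reasoning

  Bound : Set
  Bound = Fin M → ℕ

  infix 4 _∣ˢ_
  -- An entry 0 of the bound forces the coefficients in its residue class to vanish.
  _∣ˢ_ : Bound → Series → Set
  p ∣ˢ G = ∀ n → + p (n mod M) ∣ᶻ G n

  reindex-∣ : ∀ (r : Bound) {i j x} → i ≡ j → r i ℕ.∣ x → + r j ∣ᶻ + x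
  reindex-∣ r refl = ∣ᵤ⇒∣

  ∣ˢ-resp-≗ : ∀ p {F G} → F ≗ G → p ∣ˢ F → p ∣ˢ G
  ∣ˢ-resp-≗ p F≗G p∣F n = subst (_ ∣ᶻ_) (F≗G n) (p∣F n)

  ProductBound : Bound → Bound → Bound → Set
  ProductBound p q r = ∀ i j → r ((toℕ i ℕ.+ toℕ j) mod M) ℕ.∣ p i ℕ.* q j

  productBound? : ∀ p q r → Dec (ProductBound p q r)
  productBound? p q r = all? λ i → all? λ j → r ((toℕ i ℕ.+ toℕ j) mod M) ℕ.∣? p i ℕ.* q j

  SquareBound : Bound → Bound → Set
  SquareBound p r = (∀ i j → r ((toℕ i ℕ.+ toℕ j) mod M) ℕ.∣ 2 ℕ.* (p i ℕ.* p j))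
                  × (∀ i → r ((toℕ i ℕ.+ toℕ i) mod M) ℕ.∣ p i ℕ.* p i)

  squareBound? : ∀ p r → Dec (SquareBound p r)
  squareBound? p r = (all? λ i → all? λ j → r ((toℕ i ℕ.+ toℕ j) mod M) ℕ.∣? 2 ℕ.* (p i ℕ.* p j))
                 ×-dec (all? λ i → r ((toℕ i ℕ.+ toℕ i) mod M) ℕ.∣? p i ℕ.* p i)

  DilationBound : (m : ℕ) → Bound → Bound → Set
  DilationBound m p q = ∀ i → q ((toℕ i ℕ.* toℕ (m mod M)) mod M) ℕ.∣ p i

  dilationBound? : ∀ m p q → Dec (DilationBound m p q)
  dilationBound? m p q = all? λ i → q ((toℕ i ℕ.* toℕ (m mod M)) mod M) ℕ.∣? p i

  ∣ˢ-⊛ : ∀ p q r {F G} → ProductBound p q r → p ∣ˢ F → q ∣ˢ G → r ∣ˢ F ⊛ G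
  ∣ˢ-⊛ p q r {F} {G} pq∣r p∣F q∣G n = ∣-sumUpTo n _ term
    where
    term : ∀ k → k ≤ n → + r (n mod M) ∣ᶻ F k * G (n ∸ k)
    term k k≤n = ∣-trans (reindex-∣ r (mod-+-∸ k≤n) (pq∣r (k mod M) ((n ∸ k) mod M)))
                         (pos-*-pres-∣ (p∣F k) (q∣G (n ∸ k)))

  -- The terms k and n ∸ k of (F ⊛ F) n are equal, so away from the middle they come in
  -- pairs; this gains the factor 2 over ∣ˢ-⊛.
  ∣ˢ-square : ∀ p r {F} → SquareBound p r → p ∣ˢ F → r ∣ˢ F ⊛ F
  ∣ˢ-square p r {F} (p²∣2r , p²∣r) p∣F n = ∣-sumUpTo-palindrome n (λ k → F k * F (n ∸ k)) palindromic doubled middle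
    where
    palindromic : ∀ k → k ≤ n → F k * F (n ∸ k) ≡ F (n ∸ k) * F (n ∸ (n ∸ k))
    palindromic k k≤n = trans (ℤP.*-comm (F k) _) (cong (λ i → F (n ∸ k) * F i) (sym (ℕP.m∸[m∸n]≡n k≤n)))
    doubled : ∀ k → k ≤ n → + r (n mod M) ∣ᶻ F k * F (n ∸ k) + F k * F (n ∸ k)
    doubled k k≤n = subst (_ ∣ᶻ_) (twice (F k * F (n ∸ k)))
      (∣-trans (reindex-∣ r (mod-+-∸ k≤n) (p²∣2r (k mod M) ((n ∸ k) mod M)))
               (pos-*-pres-∣ (∣-refl {+ 2}) (pos-*-pres-∣ (p∣F k) (p∣F (n ∸ k)))))
      where
      twice : ∀ x → + 2 * x ≡ x + x
      twice = solve-∀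
    middle : ∀ k → k ℕ.+ k ≡ n → + r (n mod M) ∣ᶻ F k * F (n ∸ k)
    middle k refl = subst (λ i → + r ((k ℕ.+ k) mod M) ∣ᶻ F k * F i) (sym (ℕP.m+n∸m≡n k k))
      (∣-trans (reindex-∣ r (mod-+ k k) (p²∣r (k mod M)))
               (pos-*-pres-∣ (p∣F k) (p∣F k)))

  ∣ˢ-dilate : ∀ m .{{_ : NonZero m}} p q {F} → DilationBound m p q → p ∣ˢ F → q ∣ˢ dilate m F
  ∣ˢ-dilate m p q {F} pq p∣F n with m ℕ.∣? n
  ... | no  _                  = ∣0
  ... | yes (ℕ.divides k refl) = subst (λ x → + q ((k ℕ.* m) mod M) ∣ᶻ F x) (sym (m*n/n≡m k m))
    (∣-trans (reindex-∣ q (mod-* k m) (pq (k mod M))) (p∣F k))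

  ∣ˢ-one : ∀ p → p (0 mod M) ℕ.∣ 1 → p ∣ˢ one
  ∣ˢ-one p p₀∣1 zero    = ∣ᵤ⇒∣ p₀∣1
  ∣ˢ-one p p₀∣1 (suc n) = ∣0

  ∣ˢ-^ˢ : ∀ p {F} → ProductBound p p p → p (0 mod M) ℕ.∣ 1 → p ∣ˢ F → ∀ k → p ∣ˢ F ^ˢ k
  ∣ˢ-^ˢ p pp∣p p₀∣1 p∣F zero    = ∣ˢ-one p p₀∣1
  ∣ˢ-^ˢ p pp∣p p₀∣1 p∣F (suc k) = ∣ˢ-⊛ p p p pp∣p p∣F (∣ˢ-^ˢ p pp∣p p₀∣1 p∣F k)

  n∸residue≡quotient*M : ∀ n → n ∸ toℕ (n mod M) ≡ n / M ℕ.* M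
  n∸residue≡quotient*M n = begin
    n ∸ toℕ (n mod M)               ≡⟨ cong (n ∸_) (toℕ-mod n) ⟩
    n ∸ n % M                       ≡⟨ cong (_∸ n % M) (m≡m%n+[m/n]*n n M) ⟩
    n % M ℕ.+ n / M ℕ.* M ∸ n % M   ≡⟨ ℕP.m+n∸m≡n (n % M) _ ⟩
    n / M ℕ.* M                     ∎
    where open ≡-Reasoning

  shift-dilate-residue : ∀ F n → shift (toℕ (n mod M)) (dilate M F) n ≡ F (n / M)
  shift-dilate-residue F n = begin
    shift (toℕ (n mod M)) (dilate M F) n ≡⟨ shift-≤ (dilate M F) (subst (_≤ n) (sym (toℕ-mod n)) (m%n≤m n M)) ⟩
    dilate M F (n ∸ toℕ (n mod M))       ≡⟨ dilate-∣ M F (ℕ.divides (n / M) (n∸residue≡quotient*M n)) ⟩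
    F ((n ∸ toℕ (n mod M)) / M)          ≡⟨ cong (λ x → F (x / M)) (n∸residue≡quotient*M n) ⟩
    F (n / M ℕ.* M / M)                  ≡⟨ cong F (m*n/n≡m (n / M) M) ⟩
    F (n / M)                            ∎
    where open ≡-Reasoning

  shift-dilate-nonresidue : ∀ F n (j : Fin M) → j ≢ n mod M → shift (toℕ j) (dilate M F) n ≡ + 0
  shift-dilate-nonresidue F n j j≢r with toℕ j ℕ.≤? n
  ... | no  j≰n = shift-≰ (dilate M F) j≰n
  ... | yes j≤n = trans (shift-≤ (dilate M F) j≤n) (dilate-∤ M F M∤n∸j)
    where
    M∤n∸j : ¬ M ℕ.∣ n ∸ toℕ j
    M∤n∸j (ℕ.divides q n∸j≡q*M) = j≢r (trans (sym (mod-residue j q))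
      (cong (_mod M) (trans (cong (toℕ j ℕ.+_) (sym n∸j≡q*M)) (ℕP.m+[n∸m]≡n j≤n))))

  residue-decomposition : ∀ p {G} → p ∣ˢ G → Σ (Fin M → Series) λ F →
    ∀ n → G n ≡ sumFin M (λ j → + p j * shift (toℕ j) (dilate M (F j)) n)
  residue-decomposition p {G} p∣G = F , expand
    where
    p∣G-at : ∀ (j : Fin M) q → + p j ∣ᶻ G (toℕ j ℕ.+ q ℕ.* M)
    p∣G-at j q = subst (λ i → + p i ∣ᶻ G (toℕ j ℕ.+ q ℕ.* M)) (mod-residue j q) (p∣G _)

    F : Fin M → Series
    F j q = _∣ᶻ_.quotient (p∣G-at j q)

    expand : ∀ n → G n ≡ sumFin M (λ j → + p j * shift (toℕ j) (dilate M (F j)) n)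
    expand n = begin
      G n                                      ≡⟨ cong G (sym r+q*M≡n) ⟩
      G (toℕ r ℕ.+ n / M ℕ.* M)                ≡⟨ _∣ᶻ_.equality (p∣G-at r (n / M)) ⟩
      F r (n / M) * + p r                      ≡⟨ ℤP.*-comm (F r (n / M)) (+ p r) ⟩
      + p r * F r (n / M)                      ≡⟨ cong (+ p r *_) (shift-dilate-residue (F r) n) ⟨
      + p r * shift (toℕ r) (dilate M (F r)) n ≡⟨ sumFin-single M _ r other-terms ⟨
      sumFin M (λ j → + p j * shift (toℕ j) (dilate M (F j)) n) ∎
      where
      open ≡-Reasoning
      r : Fin M
      r = n mod M
      r+q*M≡n : toℕ r ℕ.+ n / M ℕ.* M ≡ n
      r+q*M≡n = trans (cong (ℕ._+ n / M ℕ.* M) (toℕ-mod n)) (sym (m≡m%n+[m/n]*n n M))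
      other-terms : ∀ j → j ≢ r → + p j * shift (toℕ j) (dilate M (F j)) n ≡ + 0
      other-terms j j≢r = trans (cong (+ p j *_) (shift-dilate-nonresidue (F j) n j j≢r)) (ℤP.*-zeroʳ (+ p j))

open ResidueBounds 8

length-filter-map-cong : ∀ {a b ℓ} {A : Set a} {B : Set b} {P : Pred B ℓ} (P? : Decidable P) {f g : A → B} →
  (∀ x → does (P? (f x)) ≡ does (P? (g x))) → ∀ xs → length (filter P? (map f xs)) ≡ length (filter P? (map g xs))
length-filter-map-cong P? f~g [] = refl
length-filter-map-cong P? {f} {g} f~g (x ∷ xs) with does (P? (f x)) | does (P? (g x)) | f~g x
... | true  | .true  | refl = cong suc (length-filter-map-cong P? f~g xs)
... | false | .false | refl = length-filter-map-cong P? f~g xs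

root? : ∀ n → Decidable (λ k → k * k ≡ + n)
root? n k = k * k ℤ.≟ + n

phi-vanishes : ∀ n → (∀ k → k * k ≢ + n) → phi n ≡ + 0
phi-vanishes n no-root = cong (+_ ∘ length) (filter-none (root? n) (universal no-root (intsUpTo n)))

-- The roots of k * k ≡ + suc n come in pairs ± k, none of them 0.
phi-suc-even : ∀ n → + 2 ∣ᶻ phi (suc n)
phi-suc-even n = subst (+ 2 ∣ᶻ_) (sym phi≡c+c) (∣ᵤ⇒∣ (ℕ.divides c (double c)))
  where
  open ≡-Reasoning
  R : Decidable (λ k → k * k ≡ + suc n)
  R = root? (suc n)

  positive negative : List ℤ
  positive = map +_ (upTo (2 ℕ.+ n))
  negative = map -[1+_] (upTo (suc n))

  c : ℕ
  c = length (filter R negative)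

  double : ∀ x → x ℕ.+ x ≡ x ℕ.* 2
  double = ℕ-solve-∀

  positive≡c : length (filter R positive) ≡ c
  positive≡c = begin
    length (filter R positive)                              ≡⟨⟩ -- 0 * 0 ≢ + suc n, so filter drops + 0 by computation
    length (filter R (map +_ (applyUpTo suc (suc n))))      ≡⟨ cong (length ∘ filter R) (map-applyUpTo suc +_ (suc n)) ⟩
    length (filter R (applyUpTo (+_ ∘ suc) (suc n)))        ≡⟨ cong (length ∘ filter R) (map-applyUpTo id (+_ ∘ suc) (suc n)) ⟨
    length (filter R (map (+_ ∘ suc) (upTo (suc n))))       ≡⟨ length-filter-map-cong R {+_ ∘ suc} { -[1+_] } (λ _ → refl) (upTo (suc n)) ⟩
    c                                                       ∎

  phi≡c+c : phi (suc n) ≡ + (c ℕ.+ c)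
  phi≡c+c = cong +_ (begin
    length (filter R (positive ++ negative))          ≡⟨ cong length (filter-++ R positive negative) ⟩
    length (filter R positive ++ filter R negative)   ≡⟨ length-++ (filter R positive) ⟩
    length (filter R positive) ℕ.+ c                  ≡⟨ cong (ℕ._+ c) positive≡c ⟩
    c ℕ.+ c                                           ∎)

phi-bound : Bound
phi-bound = lookup (1 ∷ 2 ∷ 0 ∷ 0 ∷ 2 ∷ 0 ∷ 0 ∷ 0 ∷ [])

phi-bound-cases : ∀ r → phi-bound r ≡ 0 ⊎ phi-bound r ℕ.∣ 2
phi-bound-cases = from-yes (all? λ (r : Fin 8) → phi-bound r ℕ.≟ 0 ⊎-dec phi-bound r ℕ.∣? 2)

squares-mod-8 : ∀ (i : Fin 8) → phi-bound ((toℕ i ℕ.* toℕ i) mod 8) ≢ 0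
squares-mod-8 = from-yes (all? λ (i : Fin 8) → ¬? (phi-bound ((toℕ i ℕ.* toℕ i) mod 8) ℕ.≟ 0))

square-bound≢0 : ∀ k n → k * k ≡ + n → phi-bound (n mod 8) ≢ 0
square-bound≢0 k n k²≡n = subst (λ r → phi-bound r ≢ 0) (trans (mod-* ∣ k ∣ ∣ k ∣) (cong (_mod 8) ∣k∣²≡n))
  (squares-mod-8 (∣ k ∣ mod 8))
  where
  ∣k∣²≡n : ∣ k ∣ ℕ.* ∣ k ∣ ≡ n
  ∣k∣²≡n = trans (sym (ℤP.abs-* k k)) (cong ∣_∣ k²≡n)

phi-bounded : phi-bound ∣ˢ phi
phi-bounded zero = ∣-refl
phi-bounded (suc n) with phi-bound-cases (suc n mod 8)
... | inj₁ b≡0 = subst (+ phi-bound (suc n mod 8) ∣ᶻ_) (sym (phi-vanishes (suc n) (λ k k²≡n → square-bound≢0 k (suc n) k²≡n b≡0))) ∣0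
... | inj₂ b∣2 = ∣-trans (∣ᵤ⇒∣ b∣2) (phi-suc-even n)

phi[q²]-bound phi[q⁴]-bound phi[q²]²-bound phi[q⁴]²-bound phi[q⁴]⁴-bound : Bound
phi[q²]-bound  = lookup (1 ∷ 0 ∷ 2 ∷ 0 ∷ 0 ∷ 0 ∷ 0 ∷ 0 ∷ [])
phi[q⁴]-bound  = lookup (1 ∷ 0 ∷ 0 ∷ 0 ∷ 2 ∷ 0 ∷ 0 ∷ 0 ∷ [])
phi[q²]²-bound = lookup (1 ∷ 0 ∷ 4 ∷ 0 ∷ 4 ∷ 0 ∷ 0 ∷ 0 ∷ [])
phi[q⁴]²-bound = lookup (1 ∷ 0 ∷ 0 ∷ 0 ∷ 4 ∷ 0 ∷ 0 ∷ 0 ∷ [])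
phi[q⁴]⁴-bound = lookup (1 ∷ 0 ∷ 0 ∷ 0 ∷ 8 ∷ 0 ∷ 0 ∷ 0 ∷ [])

phi·phi[q²]²-bound Φ-bound Φ²-bound : Bound
phi·phi[q²]²-bound = lookup (1 ∷ 2 ∷ 4 ∷ 8 ∷ 2 ∷ 8 ∷ 8 ∷ 0 ∷ [])
Φ-bound            = lookup (1 ∷ 2 ∷ 4 ∷ 8 ∷ 2 ∷ 8 ∷ 8 ∷ 32 ∷ [])
Φ²-bound           = lookup (1 ∷ 4 ∷ 4 ∷ 16 ∷ 4 ∷ 8 ∷ 16 ∷ 32 ∷ [])

Φ : Series
Φ = phi ⊛ (dilate 2 phi ^ˢ 2) ⊛ (dilate 4 phi ^ˢ 4)

phi[q²]²-bounded : phi[q²]²-bound ∣ˢ dilate 2 phi ^ˢ 2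
phi[q²]²-bounded = ∣ˢ-resp-≗ phi[q²]²-bound (sym ∘ ^ˢ-2 (dilate 2 phi))
  (∣ˢ-square phi[q²]-bound phi[q²]²-bound (from-yes (squareBound? phi[q²]-bound phi[q²]²-bound))
    (∣ˢ-dilate 2 phi-bound phi[q²]-bound (from-yes (dilationBound? 2 phi-bound phi[q²]-bound)) phi-bounded))

phi[q⁴]⁴-bounded : phi[q⁴]⁴-bound ∣ˢ dilate 4 phi ^ˢ 4
phi[q⁴]⁴-bounded = ∣ˢ-resp-≗ phi[q⁴]⁴-bound (λ n → sym (trans (^ˢ-*2 D 2 n) (^ˢ-2 (D ⊛ D) n)))
  (∣ˢ-square phi[q⁴]²-bound phi[q⁴]⁴-bound (from-yes (squareBound? phi[q⁴]²-bound phi[q⁴]⁴-bound))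
    (∣ˢ-square phi[q⁴]-bound phi[q⁴]²-bound (from-yes (squareBound? phi[q⁴]-bound phi[q⁴]²-bound))
      (∣ˢ-dilate 4 phi-bound phi[q⁴]-bound (from-yes (dilationBound? 4 phi-bound phi[q⁴]-bound)) phi-bounded)))
  where
  D : Series
  D = dilate 4 phi

Φ-bounded : Φ-bound ∣ˢ Φ
Φ-bounded =
  ∣ˢ-⊛ phi·phi[q²]²-bound phi[q⁴]⁴-bound Φ-bound
    (from-yes (productBound? phi·phi[q²]²-bound phi[q⁴]⁴-bound Φ-bound))
    (∣ˢ-⊛ phi-bound phi[q²]²-bound phi·phi[q²]²-bound
      (from-yes (productBound? phi-bound phi[q²]²-bound phi·phi[q²]²-bound))
      phi-bounded phi[q²]²-bounded)
    phi[q⁴]⁴-bounded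

Φ-odd-power-bounded : ∀ k → Φ-bound ∣ˢ Φ ^ˢ suc (k ℕ.* 2)
Φ-odd-power-bounded k = ∣ˢ-resp-≗ Φ-bound (⊛-congʳ Φ (sym ∘ ^ˢ-*2 Φ k))
  (∣ˢ-⊛ Φ-bound Φ²-bound Φ-bound (from-yes (productBound? Φ-bound Φ²-bound Φ-bound)) Φ-bounded
    (∣ˢ-^ˢ Φ²-bound (from-yes (productBound? Φ²-bound Φ²-bound Φ²-bound)) ℕ.∣-refl
      (∣ˢ-square Φ-bound Φ²-bound (from-yes (squareBound? Φ-bound Φ²-bound)) Φ-bounded) k))

theorem2p2 : (t : ℕ) → 1 ≤ t → t % 2 ≡ 1 →
    Σ (Fin 8 → ℤ) λ a → Σ (Fin 8 → Series) λ F →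
      ((n : ℕ) →
        ((phi ⊛ (dilate 2 phi ^ˢ 2) ⊛ (dilate 4 phi ^ˢ 4)) ^ˢ t) n
          ≡ sumFin 8 (λ j → a j * shift (toℕ j) (dilate 8 (F j)) n))
      × ((+ 2) ∣ a (# 1))
      × ((+ 4) ∣ a (# 2))
      × ((+ 8) ∣ a (# 3))
      × ((+ 2) ∣ a (# 4))
      × ((+ 8) ∣ a (# 5))
      × ((+ 8) ∣ a (# 6))
      × ((+ 32) ∣ a (# 7))
theorem2p2 t _ t-odd =
  let F , expansion = residue-decomposition Φ-bound Φ^t-bounded
  in  (λ j → + Φ-bound j) , F , expansion ,
      ℕ.∣-refl , ℕ.∣-refl , ℕ.∣-refl , ℕ.∣-refl , ℕ.∣-refl , ℕ.∣-refl , ℕ.∣-refl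
  where
  t≡1+k*2 : t ≡ suc (t / 2 ℕ.* 2)
  t≡1+k*2 = trans (m≡m%n+[m/n]*n t 2) (cong (ℕ._+ t / 2 ℕ.* 2) t-odd)

  Φ^t-bounded : Φ-bound ∣ˢ Φ ^ˢ t
  Φ^t-bounded = subst (λ s → Φ-bound ∣ˢ Φ ^ˢ s) (sym t≡1+k*2) (Φ-odd-power-bounded (t / 2))
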